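{- Let $f:2^{[n]}\to\mathbb{R}_{\ge0}$ with $f(\emptyset)=0$ be strongly 2-coverage. Then $f$ is monotone (i.e. $f(A)\le f(B)$ whenever $A\subseteq B$) and submodular (i.e. $f(S\cup\{i\})-f(S)\ge f(T\cup\{i\})-f(T)$ for all $S\subseteq T\subseteq[n]$ and $i\in[n]$).
   Context: For $\tau\subseteq[n]$, $f_\tau$ denotes the set function on $[n]\setminus\tau$ given by $f_\tau(T)=f(T\cup\tau)$. A function $g:2^{V}\to\mathbb{R}_{\ge0}$ is a coverage function if there are a finite set $U$, subsets $A_i\subseteq U$ ($i\in V$) and a nonnegative measure $w$ on $U$ with $g(T)=w(\bigcup_{i\in T}A_i)$. The function $f$ is strongly 2-coverage if for every $\tau\subseteq[n]$ with $0\le|\tau|\le n-2$ there is a coverage function $g:2^{[n]\setminus\tau}\to\mathbb{R}$ such that $f_\tau(T)=g(T)+f(\tau)$ for every $T\subseteq[n]\setminus\tau$ with $|T|\in\{1,2\}$. -}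

module Defs where

open import Level using (Level; _⊔_) renaming (suc to lsuc)
open import Data.Nat using (ℕ; zero; suc; _≤_)
import Data.Nat as ℕ
open import Data.Fin using (Fin)
open Fin
open import Data.Fin.Subset using (Subset; inside; outside; ⊥; _∪_; _⊆_; ∁; ∣_∣; ⁅_⁆)
open import Data.Vec using ([]; _∷_)
open import Data.Product using (Σ; ∃; _×_)
open import Data.Sum using (_⊎_)
open import Relation.Binary.PropositionalEquality using (_≡_)
open import Relation.Binary.Structures using (IsTotalOrder)
open import Algebra.Structures using (IsAbelianGroup)

-- The paper uses ℝ (functions into ℝ_{≥0}); the standard
-- library has no reals, so we work over an arbitrary totally ordered
-- abelian group (ℝ with +, 0, -, ≤ is an instance).
record OrderedAbelianGroup (c ℓ : Level) : Set (lsuc (c ⊔ ℓ)) where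
  infixl 6 _+_ _-_
  infix 4 _≤ᵍ_
  field
    Carrier        : Set c
    _+_            : Carrier → Carrier → Carrier
    0#             : Carrier
    -_             : Carrier → Carrier
    _≤ᵍ_           : Carrier → Carrier → Set ℓ
    isAbelianGroup : IsAbelianGroup _≡_ _+_ 0# -_
    isTotalOrder   : IsTotalOrder _≡_ _≤ᵍ_
    +-monoˡ        : ∀ {x y} z → x ≤ᵍ y → x + z ≤ᵍ y + z

  _-_ : Carrier → Carrier → Carrier
  x - y = x + (- y)

module _ {c ℓ : Level} (G : OrderedAbelianGroup c ℓ) where
  open OrderedAbelianGroup G

  weight : ∀ {m} → (Fin m → Carrier) → Subset m → Carrier
  weight {zero}  w []            = 0#
  weight {suc m} w (inside  ∷ p) = w zero + weight (λ u → w (suc u)) p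
  weight {suc m} w (outside ∷ p) = weight (λ u → w (suc u)) p

  unionOver : ∀ {n m} → (Fin n → Subset m) → Subset n → Subset m
  unionOver {zero}  A []            = ⊥
  unionOver {suc n} A (inside  ∷ T) = A zero ∪ unionOver (λ i → A (suc i)) T
  unionOver {suc n} A (outside ∷ T) = unionOver (λ i → A (suc i)) T

  IsCoverageOn : ∀ {n} → Subset n → (Subset n → Carrier) → Set (c ⊔ ℓ)
  IsCoverageOn {n} V g =
    Σ ℕ λ m → Σ (Fin n → Subset m) λ A → Σ (Fin m → Carrier) λ w →
      (∀ u → 0# ≤ᵍ w u) × (∀ T → T ⊆ V → g T ≡ weight w (unionOver A T))

  Strongly2Coverage : ∀ {n} → (Subset n → Carrier) → Set (c ⊔ ℓ)
  Strongly2Coverage {n} f =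
    ∀ (τ : Subset n) → ∣ τ ∣ ℕ.+ 2 ≤ n →
      Σ (Subset n → Carrier) λ g → IsCoverageOn (∁ τ) g ×
        (∀ T → T ⊆ ∁ τ → (∣ T ∣ ≡ 1 ⊎ ∣ T ∣ ≡ 2) → f (T ∪ τ) ≡ g T + f τ)

  Monotone : ∀ {n} → (Subset n → Carrier) → Set ℓ
  Monotone {n} f = ∀ (A B : Subset n) → A ⊆ B → f A ≤ᵍ f B

  Submodular : ∀ {n} → (Subset n → Carrier) → Set ℓ
  Submodular {n} f = ∀ (S T : Subset n) (i : Fin n) → S ⊆ T →
    f (T ∪ ⁅ i ⁆) - f T ≤ᵍ f (S ∪ ⁅ i ⁆) - f S

{-# OPTIONS --safe #-}
module Submission where

-- Fix τ and two distinct points i, j ∉ τ.  Strong 2-coverage writes f(τ+i), f(τ+j) and f(τ+i+j)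
-- as f(τ) plus the values of a single coverage function g, and coverage functions are monotone
-- and subadditive.  Hence adding j to a nonempty set X does not decrease f (take τ = X minus one
-- of its points, i = that point), and adding j to X does not increase the marginal gain of i
-- (take τ = X).  Monotonicity and submodularity follow by inserting the points of the larger set
-- one at a time; the empty set is covered by f ≥ 0 = f(∅).

open import Defs
open import Level using (Level)
open import Data.Nat using (ℕ)
open import Data.Fin.Subset using (Subset; ⊥)
open import Data.Product using (_×_)
open import Relation.Binary.PropositionalEquality using (_≡_)

open import Algebra.Bundles using (AbelianGroup; CommutativeMonoid)
open import Algebra.Structures using (IsAbelianGroup)
import Algebra.Properties.CommutativeSemigroup as CommutativeSemigroupProperties
open import Data.Bool.Properties using (∨-identityʳ)
open import Data.Empty using (⊥-elim)
open import Data.Fin using (Fin; zero; suc)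
open import Data.Fin.Subset
  using (Side; inside; outside; _∈_; _∉_; _⊆_; _∪_; _─_; ∁; ∣_∣; ⁅_⁆)
open import Data.Fin.Subset.Properties
import Data.Nat as ℕ
open import Data.Nat.Properties using (+-comm; m≤o∸n⇒m+n≤o)
open import Data.Product using (_,_; proj₁; proj₂; ∃-syntax)
open import Data.Sum using (_⊎_; inj₁; inj₂)
import Data.Sum as Sum
open import Data.Vec using ([]; _∷_; here; there)
open import Function using (_∘_; flip)
open import Relation.Binary.Bundles using (TotalOrder)
open import Relation.Binary.Core using (Rel)
open import Relation.Binary.Definitions using (Reflexive; Transitive)
open import Relation.Binary.PropositionalEquality
  using (refl; sym; trans; cong; cong₂; subst; subst₂; _≢_)
import Relation.Binary.Reasoning.PartialOrder as PartialOrderReasoning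
open import Relation.Nullary using (yes; no; contradiction)

p∪⁅x⁆≡p : ∀ {n} {x : Fin n} {p : Subset n} → x ∈ p → p ∪ ⁅ x ⁆ ≡ p
p∪⁅x⁆≡p {p = _ ∷ p} here        = cong (inside ∷_) (∪-identityʳ p)
p∪⁅x⁆≡p {p = s ∷ p} (there x∈p) = cong₂ _∷_ (∨-identityʳ s) (p∪⁅x⁆≡p x∈p)

⁅x⁆∪[p─⁅x⁆]≡p : ∀ {n} {x : Fin n} {p : Subset n} → x ∈ p → ⁅ x ⁆ ∪ (p ─ ⁅ x ⁆) ≡ p
⁅x⁆∪[p─⁅x⁆]≡p {p = _ ∷ p} here        = cong (inside ∷_) (trans (∪-identityˡ (p ─ ⊥)) (p─⊥≡p p))
⁅x⁆∪[p─⁅x⁆]≡p {p = s ∷ p} (there x∈p) = cong (s ∷_) (⁅x⁆∪[p─⁅x⁆]≡p x∈p)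

x∉p─⁅x⁆ : ∀ {n} (x : Fin n) (p : Subset n) → x ∉ p ─ ⁅ x ⁆
x∉p─⁅x⁆ zero    (s ∷ p) ()
x∉p─⁅x⁆ (suc x) (s ∷ p) x∈p─⁅x⁆ = x∉p─⁅x⁆ x p (drop-there x∈p─⁅x⁆)

∣⁅x⁆∪⁅y⁆∣≡2 : ∀ {n} {x y : Fin n} → x ≢ y → ∣ ⁅ x ⁆ ∪ ⁅ y ⁆ ∣ ≡ 2
∣⁅x⁆∪⁅y⁆∣≡2 {x = zero}  {zero}  x≢y = contradiction refl x≢y
∣⁅x⁆∪⁅y⁆∣≡2 {x = zero}  {suc y} _   = cong ℕ.suc (trans (cong ∣_∣ (∪-identityˡ ⁅ y ⁆)) (∣⁅x⁆∣≡1 y))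
∣⁅x⁆∪⁅y⁆∣≡2 {x = suc x} {zero}  _   = cong ℕ.suc (trans (cong ∣_∣ (∪-identityʳ ⁅ x ⁆)) (∣⁅x⁆∣≡1 x))
∣⁅x⁆∪⁅y⁆∣≡2 {x = suc x} {suc y} x≢y = ∣⁅x⁆∪⁅y⁆∣≡2 (x≢y ∘ cong suc)

p⊆∁q⇒∣q∣+∣p∣≤n : ∀ {n} {p q : Subset n} → p ⊆ ∁ q → ∣ q ∣ ℕ.+ ∣ p ∣ ℕ.≤ n
p⊆∁q⇒∣q∣+∣p∣≤n {n} {p} {q} p⊆∁q =
  subst (ℕ._≤ n) (+-comm ∣ p ∣ ∣ q ∣)
    (m≤o∸n⇒m+n≤o ∣ p ∣ (∣p∣≤n q) (subst (∣ p ∣ ℕ.≤_) (∣∁p∣≡n∸∣p∣ q) (p⊆q⇒∣p∣≤∣q∣ p⊆∁q)))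

∪-lub : ∀ {n} {p q r : Subset n} → p ⊆ r → q ⊆ r → p ∪ q ⊆ r
∪-lub {p = p} {q} p⊆r q⊆r x∈p∪q = Sum.[ p⊆r , q⊆r ] (x∈p∪q⁻ p q x∈p∪q)

x∈p⇒⁅x⁆⊆p : ∀ {n} {x : Fin n} {p : Subset n} → x ∈ p → ⁅ x ⁆ ⊆ p
x∈p⇒⁅x⁆⊆p {x = x} {p} x∈p y∈⁅x⁆ = subst (_∈ p) (sym (x∈⁅y⁆⇒x≡y x y∈⁅x⁆)) x∈p

module _ {a r} {A : Set a} {_≼_ : Rel A r} (≼-refl : Reflexive _≼_) (≼-trans : Transitive _≼_) where

  insertion-monotone⇒⊆-monotone : ∀ {n} (φ : Subset n → A) {q : Subset n} →
    (∀ {p x} → p ⊆ q → x ∈ q → x ∉ p → φ p ≼ φ (⁅ x ⁆ ∪ p)) →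
    ∀ {p} → p ⊆ q → φ p ≼ φ q

  insertion-monotone⇒∷-monotone : ∀ {n} (φ : Subset (ℕ.suc n) → A) {s t : Side} {q : Subset n} →
    (∀ {p x} → p ⊆ t ∷ q → x ∈ t ∷ q → x ∉ p → φ p ≼ φ (⁅ x ⁆ ∪ p)) →
    (∀ {p} → p ⊆ q → s ∷ p ⊆ t ∷ q) →
    ∀ {p} → p ⊆ q → φ (s ∷ p) ≼ φ (s ∷ q)
  insertion-monotone⇒∷-monotone φ {s} step s∷-⊆ =
    insertion-monotone⇒⊆-monotone (φ ∘ (s ∷_))
      (λ p⊆q x∈q x∉p → step (s∷-⊆ p⊆q) (there x∈q) (x∉p ∘ drop-there))

  insertion-monotone⇒⊆-monotone φ {[]} step {[]} _ = ≼-refl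
  insertion-monotone⇒⊆-monotone φ {outside ∷ q} step {outside ∷ p} p⊆q =
    insertion-monotone⇒∷-monotone φ step out⊆ (drop-∷-⊆ p⊆q)
  insertion-monotone⇒⊆-monotone φ {inside ∷ q} step {outside ∷ p} p⊆q =
    ≼-trans (insertion-monotone⇒∷-monotone φ step out⊆ (drop-∷-⊆ p⊆q))
            (subst (λ r → φ (outside ∷ q) ≼ φ (inside ∷ r)) (∪-identityˡ q)
                   (step (out⊆ ⊆-refl) here λ ()))
  insertion-monotone⇒⊆-monotone φ {inside ∷ q} step {inside ∷ p} p⊆q =
    insertion-monotone⇒∷-monotone φ step in⊆in (drop-∷-⊆ p⊆q)
  insertion-monotone⇒⊆-monotone φ {outside ∷ q} step {inside ∷ p} p⊆q with p⊆q here
  ... | ()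

module OrderedAbelianGroupProperties {c ℓ : Level} (G : OrderedAbelianGroup c ℓ) where
  open OrderedAbelianGroup G
  open IsAbelianGroup isAbelianGroup using (assoc; comm; identityˡ; identityʳ; inverseʳ)

  totalOrder : TotalOrder c c ℓ
  totalOrder = record { isTotalOrder = isTotalOrder }

  open TotalOrder totalOrder public
    using () renaming (refl to ≤ᵍ-refl; reflexive to ≤ᵍ-reflexive; trans to ≤ᵍ-trans)
  module ≤ᵍ-Reasoning = PartialOrderReasoning (TotalOrder.poset totalOrder)

  abelianGroup : AbelianGroup c c
  abelianGroup = record { isAbelianGroup = isAbelianGroup }

  open CommutativeSemigroupProperties (AbelianGroup.commutativeSemigroup abelianGroup) public
    using (x∙yz≈y∙xz)

  +-monoʳ : ∀ {x y} z → x ≤ᵍ y → z + x ≤ᵍ z + y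
  +-monoʳ {x} {y} z x≤y = subst₂ _≤ᵍ_ (comm x z) (comm y z) (+-monoˡ z x≤y)

  x≤y+x : ∀ {y} x → 0# ≤ᵍ y → x ≤ᵍ y + x
  x≤y+x {y} x 0≤y = subst (_≤ᵍ y + x) (identityˡ x) (+-monoˡ x 0≤y)

  [x+y]-y≡x : ∀ x y → (x + y) - y ≡ x
  [x+y]-y≡x x y = trans (assoc x y (- y)) (trans (cong (x +_) (inverseʳ y)) (identityʳ x))

  x≤y+z⇒x-z≤y : ∀ {x y z} → x ≤ᵍ y + z → x - z ≤ᵍ y
  x≤y+z⇒x-z≤y {y = y} {z} x≤y+z = subst (_ ≤ᵍ_) ([x+y]-y≡x y z) (+-monoˡ (- z) x≤y+z)

  x≤y⇒0≤y-x : ∀ {x y} → x ≤ᵍ y → 0# ≤ᵍ y - x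
  x≤y⇒0≤y-x {x} x≤y = subst (_≤ᵍ _) (inverseʳ x) (+-monoˡ (- x) x≤y)

module Coverage {c ℓ : Level} (G : OrderedAbelianGroup c ℓ) where
  open OrderedAbelianGroup G
  open OrderedAbelianGroupProperties G
  open IsAbelianGroup isAbelianGroup using (assoc; identityˡ)
  open ≤ᵍ-Reasoning

  weight-monotone : ∀ {m} (w : Fin m → Carrier) → (∀ u → 0# ≤ᵍ w u) →
    ∀ {p q} → p ⊆ q → weight G w p ≤ᵍ weight G w q
  weight-monotone w w≥0 {[]} {[]} _ = ≤ᵍ-refl
  weight-monotone w w≥0 {inside ∷ p} {inside ∷ q} p⊆q =
    +-monoʳ (w zero) (weight-monotone (w ∘ suc) (w≥0 ∘ suc) (drop-∷-⊆ p⊆q))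
  weight-monotone w w≥0 {outside ∷ p} {inside ∷ q} p⊆q =
    ≤ᵍ-trans (weight-monotone (w ∘ suc) (w≥0 ∘ suc) (drop-∷-⊆ p⊆q)) (x≤y+x _ (w≥0 zero))
  weight-monotone w w≥0 {outside ∷ p} {outside ∷ q} p⊆q =
    weight-monotone (w ∘ suc) (w≥0 ∘ suc) (drop-∷-⊆ p⊆q)
  weight-monotone w w≥0 {inside ∷ p} {outside ∷ q} p⊆q with p⊆q here
  ... | ()

  weight-subadditive : ∀ {m} (w : Fin m → Carrier) → (∀ u → 0# ≤ᵍ w u) →
    ∀ p q → weight G w (p ∪ q) ≤ᵍ weight G w p + weight G w q
  weight-subadditive w w≥0 [] [] = ≤ᵍ-reflexive (sym (identityˡ 0#))
  weight-subadditive w w≥0 (inside ∷ p) (inside ∷ q) = begin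
    w zero + W (p ∪ q)          ≤⟨ +-monoʳ (w zero) (weight-subadditive (w ∘ suc) (w≥0 ∘ suc) p q) ⟩
    w zero + (W p + W q)        ≡⟨ sym (assoc (w zero) (W p) (W q)) ⟩
    (w zero + W p) + W q        ≤⟨ +-monoʳ _ (x≤y+x (W q) (w≥0 zero)) ⟩
    (w zero + W p) + (w zero + W q) ∎
    where W = weight G (w ∘ suc)
  weight-subadditive w w≥0 (inside ∷ p) (outside ∷ q) = begin
    w zero + W (p ∪ q)          ≤⟨ +-monoʳ (w zero) (weight-subadditive (w ∘ suc) (w≥0 ∘ suc) p q) ⟩
    w zero + (W p + W q)        ≡⟨ sym (assoc (w zero) (W p) (W q)) ⟩
    (w zero + W p) + W q        ∎
    where W = weight G (w ∘ suc)
  weight-subadditive w w≥0 (outside ∷ p) (inside ∷ q) = begin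
    w zero + W (p ∪ q)          ≤⟨ +-monoʳ (w zero) (weight-subadditive (w ∘ suc) (w≥0 ∘ suc) p q) ⟩
    w zero + (W p + W q)        ≡⟨ x∙yz≈y∙xz (w zero) (W p) (W q) ⟩
    W p + (w zero + W q)        ∎
    where W = weight G (w ∘ suc)
  weight-subadditive w w≥0 (outside ∷ p) (outside ∷ q) =
    weight-subadditive (w ∘ suc) (w≥0 ∘ suc) p q

  x∈unionOver⁺ : ∀ {n m} (A : Fin n → Subset m) {T i u} → i ∈ T → u ∈ A i → u ∈ unionOver G A T
  x∈unionOver⁺ A {inside ∷ T} here        u∈A₀ = x∈p∪q⁺ (inj₁ u∈A₀)
  x∈unionOver⁺ A {inside ∷ T} (there i∈T) u∈Aᵢ = x∈p∪q⁺ (inj₂ (x∈unionOver⁺ (A ∘ suc) i∈T u∈Aᵢ))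
  x∈unionOver⁺ A {outside ∷ T} (there i∈T) u∈Aᵢ = x∈unionOver⁺ (A ∘ suc) i∈T u∈Aᵢ

  x∈unionOver⁻ : ∀ {n m} (A : Fin n → Subset m) T {u} → u ∈ unionOver G A T → ∃[ i ] i ∈ T × u ∈ A i
  x∈unionOver⁻ A [] u∈⊥ = ⊥-elim (∉⊥ u∈⊥)
  x∈unionOver⁻ A (inside ∷ T) u∈ with x∈p∪q⁻ (A zero) _ u∈
  ... | inj₁ u∈A₀ = zero , here , u∈A₀
  ... | inj₂ u∈rest with x∈unionOver⁻ (A ∘ suc) T u∈rest
  ...   | i , i∈T , u∈Aᵢ = suc i , there i∈T , u∈Aᵢ
  x∈unionOver⁻ A (outside ∷ T) u∈ with x∈unionOver⁻ (A ∘ suc) T u∈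
  ... | i , i∈T , u∈Aᵢ = suc i , there i∈T , u∈Aᵢ

  unionOver-monotone : ∀ {n m} (A : Fin n → Subset m) {T T'} → T ⊆ T' → unionOver G A T ⊆ unionOver G A T'
  unionOver-monotone A {T} T⊆T' u∈ with x∈unionOver⁻ A T u∈
  ... | i , i∈T , u∈Aᵢ = x∈unionOver⁺ A (T⊆T' i∈T) u∈Aᵢ

  unionOver-∪ : ∀ {n m} (A : Fin n → Subset m) T T' →
    unionOver G A (T ∪ T') ⊆ unionOver G A T ∪ unionOver G A T'
  unionOver-∪ A T T' u∈ with x∈unionOver⁻ A (T ∪ T') u∈
  ... | i , i∈T∪T' , u∈Aᵢ =
    x∈p∪q⁺ (Sum.map (λ i∈T → x∈unionOver⁺ A i∈T u∈Aᵢ) (λ i∈T' → x∈unionOver⁺ A i∈T' u∈Aᵢ)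
                    (x∈p∪q⁻ T T' i∈T∪T'))

  coverage-monotone : ∀ {n} {V : Subset n} {g : Subset n → Carrier} → IsCoverageOn G V g →
    ∀ {S T} → S ⊆ T → T ⊆ V → g S ≤ᵍ g T
  coverage-monotone {g = g} (_ , A , w , w≥0 , g≡) {S} {T} S⊆T T⊆V = begin
    g S                     ≡⟨ g≡ S (⊆-trans S⊆T T⊆V) ⟩
    weight G w (unionOver G A S) ≤⟨ weight-monotone w w≥0 (unionOver-monotone A S⊆T) ⟩
    weight G w (unionOver G A T) ≡⟨ sym (g≡ T T⊆V) ⟩
    g T                     ∎

  coverage-subadditive : ∀ {n} {V : Subset n} {g : Subset n → Carrier} → IsCoverageOn G V g →
    ∀ {S T} → S ⊆ V → T ⊆ V → g (S ∪ T) ≤ᵍ g S + g T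
  coverage-subadditive {g = g} (_ , A , w , w≥0 , g≡) {S} {T} S⊆V T⊆V = begin
    g (S ∪ T)                     ≡⟨ g≡ (S ∪ T) (∪-lub S⊆V T⊆V) ⟩
    W (unionOver G A (S ∪ T))      ≤⟨ weight-monotone w w≥0 (unionOver-∪ A S T) ⟩
    W (unionOver G A S ∪ unionOver G A T) ≤⟨ weight-subadditive w w≥0 _ _ ⟩
    W (unionOver G A S) + W (unionOver G A T) ≡⟨ sym (cong₂ _+_ (g≡ S S⊆V) (g≡ T T⊆V)) ⟩
    g S + g T                     ∎
    where W = weight G w

module TwoPoint {c ℓ : Level} (G : OrderedAbelianGroup c ℓ) {n : ℕ}
  {f : Subset n → OrderedAbelianGroup.Carrier G} (f-s2c : Strongly2Coverage G f)
  {τ : Subset n} {i j : Fin n} (i∉τ : i ∉ τ) (j∉τ : j ∉ τ) (i≢j : i ≢ j) where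

  open OrderedAbelianGroup G
  open OrderedAbelianGroupProperties G
  open Coverage G
  open IsAbelianGroup isAbelianGroup using (assoc)
  open ≤ᵍ-Reasoning

  ⁅x⁆⊆∁τ : ∀ {x} → x ∉ τ → ⁅ x ⁆ ⊆ ∁ τ
  ⁅x⁆⊆∁τ = x∈p⇒⁅x⁆⊆p ∘ x∉p⇒x∈∁p

  ⁅i⁆∪⁅j⁆⊆∁τ : ⁅ i ⁆ ∪ ⁅ j ⁆ ⊆ ∁ τ
  ⁅i⁆∪⁅j⁆⊆∁τ = ∪-lub (⁅x⁆⊆∁τ i∉τ) (⁅x⁆⊆∁τ j∉τ)

  ∣τ∣+2≤n : ∣ τ ∣ ℕ.+ 2 ℕ.≤ n
  ∣τ∣+2≤n = subst (λ k → ∣ τ ∣ ℕ.+ k ℕ.≤ n) (∣⁅x⁆∪⁅y⁆∣≡2 i≢j) (p⊆∁q⇒∣q∣+∣p∣≤n ⁅i⁆∪⁅j⁆⊆∁τ)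

  g : Subset n → Carrier
  g = proj₁ (f-s2c τ ∣τ∣+2≤n)

  g-coverage : IsCoverageOn G (∁ τ) g
  g-coverage = proj₁ (proj₂ (f-s2c τ ∣τ∣+2≤n))

  f[T∪τ]≡g[T]+f[τ] : ∀ T → T ⊆ ∁ τ → ∣ T ∣ ≡ 1 ⊎ ∣ T ∣ ≡ 2 → f (T ∪ τ) ≡ g T + f τ
  f[T∪τ]≡g[T]+f[τ] = proj₂ (proj₂ (f-s2c τ ∣τ∣+2≤n))

  f[⁅x⁆∪τ] : ∀ {x} → x ∉ τ → f (⁅ x ⁆ ∪ τ) ≡ g ⁅ x ⁆ + f τ
  f[⁅x⁆∪τ] {x} x∉τ = f[T∪τ]≡g[T]+f[τ] ⁅ x ⁆ (⁅x⁆⊆∁τ x∉τ) (inj₁ (∣⁅x⁆∣≡1 x))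

  f[⁅i⁆∪⁅j⁆∪τ] : f ((⁅ i ⁆ ∪ ⁅ j ⁆) ∪ τ) ≡ g (⁅ i ⁆ ∪ ⁅ j ⁆) + f τ
  f[⁅i⁆∪⁅j⁆∪τ] = f[T∪τ]≡g[T]+f[τ] (⁅ i ⁆ ∪ ⁅ j ⁆) ⁅i⁆∪⁅j⁆⊆∁τ (inj₂ (∣⁅x⁆∪⁅y⁆∣≡2 i≢j))

  pair-increasing : f (⁅ i ⁆ ∪ τ) ≤ᵍ f ((⁅ i ⁆ ∪ ⁅ j ⁆) ∪ τ)
  pair-increasing = begin
    f (⁅ i ⁆ ∪ τ)               ≡⟨ f[⁅x⁆∪τ] i∉τ ⟩
    g ⁅ i ⁆ + f τ               ≤⟨ +-monoˡ (f τ) (coverage-monotone g-coverage (p⊆p∪q ⁅ j ⁆) ⁅i⁆∪⁅j⁆⊆∁τ) ⟩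
    g (⁅ i ⁆ ∪ ⁅ j ⁆) + f τ     ≡⟨ f[⁅i⁆∪⁅j⁆∪τ] ⟨
    f ((⁅ i ⁆ ∪ ⁅ j ⁆) ∪ τ)     ∎

  pair-submodular : f ((⁅ i ⁆ ∪ ⁅ j ⁆) ∪ τ) - f (⁅ j ⁆ ∪ τ) ≤ᵍ f (⁅ i ⁆ ∪ τ) - f τ
  pair-submodular = x≤y+z⇒x-z≤y (begin
    f ((⁅ i ⁆ ∪ ⁅ j ⁆) ∪ τ)           ≡⟨ f[⁅i⁆∪⁅j⁆∪τ] ⟩
    g (⁅ i ⁆ ∪ ⁅ j ⁆) + f τ           ≤⟨ +-monoˡ (f τ) g-subadditive ⟩
    (g ⁅ i ⁆ + g ⁅ j ⁆) + f τ         ≡⟨ assoc (g ⁅ i ⁆) (g ⁅ j ⁆) (f τ) ⟩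
    g ⁅ i ⁆ + (g ⁅ j ⁆ + f τ)         ≡⟨ cong₂ _+_ ([x+y]-y≡x (g ⁅ i ⁆) (f τ)) (f[⁅x⁆∪τ] j∉τ) ⟨
    ((g ⁅ i ⁆ + f τ) - f τ) + f (⁅ j ⁆ ∪ τ) ≡⟨ cong (λ v → (v - f τ) + f (⁅ j ⁆ ∪ τ)) (f[⁅x⁆∪τ] i∉τ) ⟨
    (f (⁅ i ⁆ ∪ τ) - f τ) + f (⁅ j ⁆ ∪ τ) ∎)
    where
    g-subadditive : g (⁅ i ⁆ ∪ ⁅ j ⁆) ≤ᵍ g ⁅ i ⁆ + g ⁅ j ⁆
    g-subadditive = coverage-subadditive g-coverage (⁅x⁆⊆∁τ i∉τ) (⁅x⁆⊆∁τ j∉τ)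

module _ {c ℓ : Level} (G : OrderedAbelianGroup c ℓ) {n : ℕ}
  {f : Subset n → OrderedAbelianGroup.Carrier G}
  (f≥0 : ∀ S → OrderedAbelianGroup._≤ᵍ_ G (OrderedAbelianGroup.0# G) (f S))
  (f⊥≡0 : f ⊥ ≡ OrderedAbelianGroup.0# G)
  (f-s2c : Strongly2Coverage G f) where

  open OrderedAbelianGroup G
  open OrderedAbelianGroupProperties G
  open IsAbelianGroup isAbelianGroup using (inverseʳ)
  open TwoPoint G f-s2c using (pair-increasing; pair-submodular)
  open CommutativeSemigroupProperties (CommutativeMonoid.commutativeSemigroup (∪-commutativeMonoid n))
    using (xy∙z≈y∙xz; xy∙z≈zx∙y)
  open ≤ᵍ-Reasoning

  insertion-increasing : ∀ {X j} → j ∉ X → f X ≤ᵍ f (⁅ j ⁆ ∪ X)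
  insertion-increasing {X} {j} j∉X with nonempty? X
  ... | no X-empty = begin
    f X             ≡⟨ cong f (Empty-unique X-empty) ⟩
    f ⊥             ≡⟨ f⊥≡0 ⟩
    0#              ≤⟨ f≥0 (⁅ j ⁆ ∪ X) ⟩
    f (⁅ j ⁆ ∪ X)   ∎
  ... | yes (k , k∈X) = begin
    f X                         ≡⟨ cong f X≡⁅k⁆∪τ ⟩
    f (⁅ k ⁆ ∪ τ)               ≤⟨ pair-increasing (x∉p─⁅x⁆ k X) (j∉X ∘ p─q⊆p X ⁅ k ⁆) k≢j ⟩
    f ((⁅ k ⁆ ∪ ⁅ j ⁆) ∪ τ)     ≡⟨ cong f (xy∙z≈y∙xz ⁅ k ⁆ ⁅ j ⁆ τ) ⟩
    f (⁅ j ⁆ ∪ ⁅ k ⁆ ∪ τ)       ≡⟨ cong (λ Y → f (⁅ j ⁆ ∪ Y)) X≡⁅k⁆∪τ ⟨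
    f (⁅ j ⁆ ∪ X)               ∎
    where
    τ : Subset n
    τ = X ─ ⁅ k ⁆
    X≡⁅k⁆∪τ : X ≡ ⁅ k ⁆ ∪ τ
    X≡⁅k⁆∪τ = sym (⁅x⁆∪[p─⁅x⁆]≡p k∈X)
    k≢j : k ≢ j
    k≢j refl = j∉X k∈X

  f-monotone : Monotone G f
  f-monotone _ _ = insertion-monotone⇒⊆-monotone {_≼_ = _≤ᵍ_} ≤ᵍ-refl ≤ᵍ-trans f (λ _ _ → insertion-increasing)

  marginal : Fin n → Subset n → Carrier
  marginal i Y = f (Y ∪ ⁅ i ⁆) - f Y

  marginal-absorbed : ∀ {i Y} → i ∈ Y → marginal i Y ≡ 0#
  marginal-absorbed {Y = Y} i∈Y = trans (cong (λ Z → f Z - f Y) (p∪⁅x⁆≡p i∈Y)) (inverseʳ (f Y))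

  marginal-diminishing : ∀ {X i j} → i ∉ X → j ∉ X → i ≢ j → marginal i (⁅ j ⁆ ∪ X) ≤ᵍ marginal i X
  marginal-diminishing {X} {i} {j} i∉X j∉X i≢j = begin
    f ((⁅ j ⁆ ∪ X) ∪ ⁅ i ⁆) - f (⁅ j ⁆ ∪ X) ≡⟨ cong (λ Y → f Y - f (⁅ j ⁆ ∪ X)) (xy∙z≈zx∙y ⁅ j ⁆ X ⁅ i ⁆) ⟩
    f ((⁅ i ⁆ ∪ ⁅ j ⁆) ∪ X) - f (⁅ j ⁆ ∪ X) ≤⟨ pair-submodular i∉X j∉X i≢j ⟩
    f (⁅ i ⁆ ∪ X) - f X                     ≡⟨ cong (λ Y → f Y - f X) (∪-comm ⁅ i ⁆ X) ⟩
    f (X ∪ ⁅ i ⁆) - f X                     ∎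

  f-submodular : Submodular G f
  f-submodular S T i S⊆T with i ∈? S | i ∈? T
  ... | yes i∈S | _ = ≤ᵍ-reflexive (trans (marginal-absorbed (S⊆T i∈S)) (sym (marginal-absorbed i∈S)))
  ... | no _ | yes i∈T = begin
    marginal i T ≡⟨ marginal-absorbed i∈T ⟩
    0#           ≤⟨ x≤y⇒0≤y-x (f-monotone S (S ∪ ⁅ i ⁆) (p⊆p∪q ⁅ i ⁆)) ⟩
    marginal i S ∎
  ... | no _ | no i∉T =
    insertion-monotone⇒⊆-monotone {_≼_ = flip _≤ᵍ_} ≤ᵍ-refl (flip ≤ᵍ-trans) (marginal i)
      (λ X⊆T j∈T j∉X → marginal-diminishing (i∉T ∘ X⊆T) j∉X λ { refl → i∉T j∈T }) S⊆T

mainTheorem5 : ∀ {c ℓ : Level} (G : OrderedAbelianGroup c ℓ) (n : ℕ)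
    (f : Subset n → OrderedAbelianGroup.Carrier G) →
    (∀ S → OrderedAbelianGroup._≤ᵍ_ G (OrderedAbelianGroup.0# G) (f S)) →
    f ⊥ ≡ OrderedAbelianGroup.0# G →
    Strongly2Coverage G f →
    Monotone G f × Submodular G f
mainTheorem5 G n f f≥0 f⊥≡0 f-s2c = f-monotone G f≥0 f⊥≡0 f-s2c , f-submodular G f≥0 f⊥≡0 f-s2c
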